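{- Every population protocol satisfying layered termination satisfies termination, i.e. for every configuration $C$ there is a terminal configuration $C'$ with $C \xrightarrow{*} C'$.
   Context: A population over a finite set $E$ is a map $M : E \to \mathbb{N}$ with $\sum_e M(e) \ge 2$. A population protocol is a tuple $\mathcal{P} = (Q, T, \Sigma, I, O)$: $Q$ a nonempty finite set of states; $T \subseteq Q^2 \times Q^2$ such that for every $(p,q)$ there is $(p',q')$ with $(p,q,p',q') \in T$; $\Sigma$ a nonempty finite alphabet; $I : \Sigma \to Q$; $O : Q \to \{0,1\}$. Configurations are populations over $Q$. For $t = (p,q,p',q')$, $\mathrm{pre}(t)$, $\mathrm{post}(t)$ are the multisets $\{p,q\}$, $\{p',q'\}$; $t$ is enabled at $C$ if $C \ge \mathrm{pre}(t)$, leading to $C - \mathrm{pre}(t) + \mathrm{post}(t)$; $\xrightarrow{*}$ is reachability. An execution is an infinite sequence of configurations each obtained from the previous by an enabled transition; it is silent if eventually constant. $C$ is terminal in a protocol if every configuration reachable from $C$ there equals $C$. For $S \subseteq T$, $\mathcal{P}[S] = (Q, S \cup \{(p,q,p,q): p,q\in Q\}, \Sigma, I, O)$ with reachability $\xrightarrow{*}_S$. An ordered partition of $T$ is a tuple $(T_1,\dots,T_n)$ of nonempty pairwise disjoint subsets with union $T$. $\mathcal{P}$ satisfies layered termination if there is an ordered partition $(T_1,\dots,T_n)$ of $T$ such that for every $i$: (a) for every configuration $C$, every (fair or unfair) execution of $\mathcal{P}[T_i]$ from $C$ is silent; (b) for all configurations $C, C'$, if $C \xrightarrow{*}_{T_i}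 C'$ and $C$ is terminal in $\mathcal{P}[T_1\cup\dots\cup T_{i-1}]$, then $C'$ is terminal in $\mathcal{P}[T_1\cup\dots\cup T_{i-1}]$. -}

module Defs where

open import Data.Nat using (ℕ; suc; _+_; _∸_; _≤_)
open import Data.Fin using (Fin; _≟_; _<_)
open import Data.Bool using (Bool; true)
open import Data.Vec using (tabulate)
open import Data.Vec using () renaming (sum to vsum)
open import Data.Product using (Σ; ∃; ∃-syntax; _×_; _,_; proj₁)
open import Data.Sum using (_⊎_)
open import Relation.Nullary using (does)
open import Relation.Binary.PropositionalEquality using (_≡_)
open import Relation.Binary.Construct.Closure.ReflexiveTransitive using (Star)

-- States: Q = Fin nQ (nonempty: nQ = suc _ is enforced in the record).
-- Transitions: elements of Q² × Q², written (p , q , p' , q').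
Trans : ℕ → Set
Trans n = Fin n × Fin n × Fin n × Fin n

TransSet : ℕ → Set
TransSet n = Trans n → Bool

δ : ∀ {n} → Fin n → Fin n → ℕ
δ a b with does (a ≟ b)
... | true  = 1
... | _     = 0

pre : ∀ {n} → Trans n → Fin n → ℕ
pre (p , q , _ , _) s = δ p s + δ q s

post : ∀ {n} → Trans n → Fin n → ℕ
post (_ , _ , p' , q') s = δ p' s + δ q' s

size : ∀ {n} → (Fin n → ℕ) → ℕ
size M = vsum (tabulate M)

Config : ℕ → Set
Config n = Σ (Fin n → ℕ) λ M → 2 ≤ size M

_≈_ : ∀ {n} → Config n → Config n → Set
C ≈ D = ∀ s → proj₁ C s ≡ proj₁ D s

record Protocol : Set where
  field
    k     : ℕ                  -- Q = Fin (suc k), nonempty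
    T     : TransSet (suc k)
    total : ∀ p q → ∃[ p' ] ∃[ q' ] T (p , q , p' , q') ≡ true
    m     : ℕ                  -- Σ = Fin (suc m), nonempty
    I     : Fin (suc m) → Fin (suc k)
    O     : Fin (suc k) → Bool

Step : ∀ {n} → (Trans n → Set) → Config n → Config n → Set
Step S C C' = ∃[ t ] (S t × (∀ s → pre t s ≤ proj₁ C s)
                        × (∀ s → proj₁ C' s ≡ (proj₁ C s ∸ pre t s) + post t s))

Reach : ∀ {n} → (Trans n → Set) → Config n → Config n → Set
Reach S = Star (Step S)

Terminal : ∀ {n} → (Trans n → Set) → Config n → Set
Terminal S C = ∀ C' → Reach S C C' → C' ≈ C

IsIdle : ∀ {n} → Trans n → Set
IsIdle (p , q , p' , q') = (p' ≡ p) × (q' ≡ q)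

-- transitions of P[S] = S ∪ {(p,q,p,q)}
Restrict : ∀ {n} → (Trans n → Set) → Trans n → Set
Restrict S t = S t ⊎ IsIdle t

IsExecution : ∀ {n} → (Trans n → Set) → Config n → (ℕ → Config n) → Set
IsExecution S C e = (e 0 ≈ C) × (∀ i → Step S (e i) (e (suc i)))

Silent : ∀ {n} → (ℕ → Config n) → Set
Silent e = ∃[ N ] (∀ i → N ≤ i → e i ≈ e N)

record OrderedPartition {n} (T : TransSet n) : Set where
  field
    l        : ℕ
    layer    : Fin l → TransSet n
    nonempty : ∀ i → ∃[ t ] layer i t ≡ true
    disjoint : ∀ i j t → layer i t ≡ true → layer j t ≡ true → i ≡ j
    cover₁   : ∀ t → T t ≡ true → ∃[ i ] layer i t ≡ true
    cover₂   : ∀ t i → layer i t ≡ true → T t ≡ true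

  Layer : Fin l → Trans n → Set
  Layer i t = layer i t ≡ true

  Below : Fin l → Trans n → Set
  Below i t = ∃[ j ] (j < i × layer j t ≡ true)

LayeredTermination : Protocol → Set
LayeredTermination P =
  Σ (OrderedPartition T) λ π → let open OrderedPartition π in
    ∀ i →
      (∀ C e → IsExecution (Restrict (Layer i)) C e → Silent e)
    × (∀ C C' → Reach (Restrict (Layer i)) C C'
         → Terminal (Restrict (Below i)) C → Terminal (Restrict (Below i)) C')
  where open Protocol P

Termination : Protocol → Set
Termination P = ∀ (C : Config (suc k)) →
  ∃[ C' ] (Reach (λ t → T t ≡ true) C C' × Terminal (λ t → T t ≡ true) C')
  where open Protocol P

-- Handle the layers one after another. For a layer T_i, run P[T_i] greedily: take a
-- T_i-step that changes the configuration whenever one exists (decidable, everything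
-- being finite) and an idle step otherwise. This is an execution, so by (a) it becomes
-- constant, and where it does no T_i-step can change the configuration any more. By (b)
-- the configuration is still terminal for T_1 ∪ … ∪ T_{i-1}, hence terminal for
-- T_1 ∪ … ∪ T_i. After the last layer it is terminal for T.
module Submission where

open import Defs
open import Data.Nat as Nat using (ℕ; zero; suc; _≤_; z≤n; s≤s; s≤s⁻¹)
open import Data.Nat.Properties using (m∸n+n≡m; ≤-refl; n≤1+n; <⇒≤; m<1+n⇒m<n∨m≡n)
open import Data.Fin using (Fin; zero; suc; toℕ; fromℕ<; _≟_)
open import Data.Fin.Properties using (any?; all?; toℕ-fromℕ<; toℕ-injective; toℕ<n)
open import Data.Bool using (true)
import Data.Bool.Properties as Bool
open import Data.Vec using () renaming (sum to vsum)
open import Data.Vec.Properties using (tabulate-cong)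
open import Data.Product using (Σ-syntax; ∃; ∃-syntax; _×_; _,_; proj₁; proj₂)
open import Data.Sum using (_⊎_; inj₁; inj₂; [_,_]; map₁)
open import Data.Empty using (⊥-elim)
open import Function using (_∘_)
open import Relation.Nullary using (¬_; Dec; yes; no)
open import Relation.Nullary.Decidable using (_×-dec_; _⊎-dec_; ¬?)
open import Relation.Unary using (Decidable; _⊆_; _∪_)
open import Relation.Binary.PropositionalEquality using (_≡_; refl; sym; trans; cong; subst)
open import Relation.Binary.Construct.Closure.ReflexiveTransitive using (ε; _◅_; _◅◅_; gmap)

module _ {n : ℕ} where

  private
    variable
      S A B : Trans n → Set
      C : Config n

  _≈?_ : (C D : Config n) → Dec (C ≈ D)
  C ≈? D = all? (λ s → proj₁ C s Nat.≟ proj₁ D s)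

  Reach-mono : ∀ {C X} → A ⊆ B → Reach A C X → Reach B C X
  Reach-mono A⊆B = gmap (λ C → C) λ { (t , a , enabled , eq) → t , A⊆B a , enabled , eq }

  Step-respˡ : ∀ C D X → C ≈ D → Step S C X → Step S D X
  Step-respˡ C D X C≈D (t , st , enabled , eq) =
    t , st , (λ s → subst (pre t s ≤_) (C≈D s) (enabled s)) ,
    λ s → trans (eq s) (cong (λ c → (c Nat.∸ pre t s) Nat.+ post t s) (C≈D s))

  Step-idle : ∀ C X → Step (IsIdle {n}) C X → X ≈ C
  Step-idle C X ((p , q , .p , .q) , (refl , refl) , enabled , eq) s =
    trans (eq s) (m∸n+n≡m (enabled s))

  record Stuck (S : Trans n → Set) (C : Config n) : Set where
    field
      unchanged : ∀ X → Step S C X → X ≈ C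
  open Stuck

  Stuck-respˡ : ∀ {D} → D ≈ C → Stuck S C → Stuck S D
  unchanged (Stuck-respˡ {C = C} {D = D} D≈C C-stuck) X st s =
    trans (unchanged C-stuck X (Step-respˡ D C X D≈C st) s) (sym (D≈C s))

  Stuck-idle : S ⊆ IsIdle → Stuck S C
  unchanged (Stuck-idle {C = C} S⊆IsIdle) X (t , st , enabled , eq) =
    Step-idle C X (t , S⊆IsIdle st , enabled , eq)

  Terminal⇒Stuck : Terminal S C → Stuck S C
  unchanged (Terminal⇒Stuck terminal) X st = terminal X (st ◅ ε)

  Stuck⇒Terminal : Stuck S C → Terminal S C
  Stuck⇒Terminal C-stuck X ε s = refl
  Stuck⇒Terminal {C = C} C-stuck X (_◅_ {j = Y} st steps) s =
    trans (Stuck⇒Terminal (Stuck-respˡ Y≈C C-stuck) X steps s) (Y≈C s)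
    where
    Y≈C : Y ≈ C
    Y≈C = unchanged C-stuck Y st

  Terminal-respˡ : ∀ {D} → D ≈ C → Terminal S C → Terminal S D
  Terminal-respˡ D≈C = Stuck⇒Terminal ∘ Stuck-respˡ D≈C ∘ Terminal⇒Stuck

  Terminal-anti : A ⊆ B → Terminal B C → Terminal A C
  Terminal-anti A⊆B terminal X steps = terminal X (Reach-mono A⊆B steps)

  Terminal-∪ : S ⊆ A ∪ B → Terminal A C → Terminal B C → Terminal S C
  Terminal-∪ S⊆A∪B terminalᴬ terminalᴮ = Stuck⇒Terminal record { unchanged = λ X (t , st , enabled , eq) →
    [ (λ a → unchanged (Terminal⇒Stuck terminalᴬ) X (t , a , enabled , eq))
    , (λ b → unchanged (Terminal⇒Stuck terminalᴮ) X (t , b , enabled , eq)) ] (S⊆A∪B st) }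

  Reach-dropIdle : ∀ {D X} → D ≈ C → Reach (Restrict S) C X → ∃[ Y ] (Reach S D Y × Y ≈ X)
  Reach-dropIdle {D = D} D≈C ε = D , ε , D≈C
  Reach-dropIdle {C = C} {D = D} D≈C (_◅_ {j = Z} (t , inj₁ st , enabled , eq) steps)
    with Reach-dropIdle {D = Z} (λ s → refl) steps
  ... | Y , steps′ , Y≈X =
    Y , Step-respˡ C D Z (λ s → sym (D≈C s)) (t , st , enabled , eq) ◅ steps′ , Y≈X
  Reach-dropIdle {C = C} D≈C (_◅_ {j = Z} (t , inj₂ idle , enabled , eq) steps) =
    Reach-dropIdle (λ s → trans (D≈C s) (sym (Step-idle C Z (t , idle , enabled , eq) s))) steps

occupied-state : ∀ {n} (M : Fin n → ℕ) → 1 ≤ size M → ∃[ q ] (∀ s → δ q s ≤ M s)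
occupied-state {suc n} M one≤size with M zero in eq
... | suc _ = zero , λ { zero → subst (1 ≤_) (sym eq) (s≤s z≤n) ; (suc s) → z≤n }
... | zero with occupied-state (M ∘ suc) one≤size
...   | q , q≤M = suc q , λ { zero → z≤n ; (suc s) → q≤M s }

two-agents : ∀ {n} (M : Fin n → ℕ) → 2 ≤ size M → ∃[ p ] ∃[ q ] (∀ s → δ p s Nat.+ δ q s ≤ M s)
two-agents {suc n} M two≤size with M zero in eq
... | suc (suc _) = zero , zero , λ { zero → subst (2 ≤_) (sym eq) (s≤s (s≤s z≤n)) ; (suc s) → z≤n }
... | suc zero with occupied-state (M ∘ suc) (s≤s⁻¹ two≤size)
...   | q , q≤M = zero , suc q , λ { zero → subst (1 ≤_) (sym eq) ≤-refl ; (suc s) → q≤M s }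
two-agents {suc n} M two≤size | zero with two-agents (M ∘ suc) two≤size
...   | p , q , pq≤M = suc p , suc q , λ { zero → z≤n ; (suc s) → pq≤M s }

idle-step : ∀ {n} {S : Trans n → Set} (C : Config n) → Step (Restrict S) C C
idle-step (M , two≤size) with two-agents M two≤size
... | p , q , enabled =
  (p , q , p , q) , inj₂ (refl , refl) , enabled , λ s → sym (m∸n+n≡m (enabled s))

any-transition? : ∀ {n} {P : Trans n → Set} → Decidable P → Dec (∃ P)
any-transition? P? with any? (λ p → any? (λ q → any? (λ p′ → any? (λ q′ → P? (p , q , p′ , q′)))))
... | yes (p , q , p′ , q′ , holds) = yes ((p , q , p′ , q′) , holds)
... | no none = no λ { ((p , q , p′ , q′) , holds) → none (p , q , p′ , q′ , holds) }

IsIdle? : ∀ {n} → Decidable (IsIdle {n})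
IsIdle? (p , q , p′ , q′) = (p′ ≟ p) ×-dec (q′ ≟ q)

module _ {n : ℕ} {S : Trans n → Set} (S? : Decidable S) where

  after : Config n → Trans n → Fin n → ℕ
  after C t s = (proj₁ C s Nat.∸ pre t s) Nat.+ post t s

  -- The size condition is redundant (steps preserve the population size), but it is what
  -- lets [after C t] be used as a configuration.
  Effective : Config n → Trans n → Set
  Effective C t = S t × (∀ s → pre t s ≤ proj₁ C s) × 2 ≤ size (after C t)
                × ¬ (∀ s → after C t s ≡ proj₁ C s)

  effective? : (C : Config n) → Decidable (Effective C)
  effective? C t = S? t ×-dec all? (λ s → pre t s Nat.≤? proj₁ C s)
                 ×-dec (2 Nat.≤? size (after C t)) ×-dec ¬? (all? (λ s → after C t s Nat.≟ proj₁ C s))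

  progress-or-stuck : (C : Config n) → (∃[ D ] (Step S C D × ¬ D ≈ C)) ⊎ Stuck S C
  progress-or-stuck C with any-transition? (effective? C)
  ... | yes (t , st , enabled , two≤size , changes) =
    inj₁ ((after C t , two≤size) , (t , st , enabled , λ _ → refl) , changes)
  ... | no none = inj₂ (record { unchanged = no-change })
    where
    no-change : ∀ X → Step S C X → X ≈ C
    no-change X (t , st , enabled , eq) with X ≈? C
    ... | yes X≈C = X≈C
    ... | no X≉C = ⊥-elim (none (t , st , enabled ,
          subst (2 ≤_) (cong vsum (tabulate-cong eq)) (proj₂ X) ,
          λ fixes → X≉C λ s → trans (eq s) (fixes s)))

module Greedy {n : ℕ} {S : Trans n → Set} (S? : Decidable S) where

  successor : (C : Config n) →
              Σ[ D ∈ Config n ] (Step (Restrict S) C D × (D ≈ C → Stuck (Restrict S) C))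
  successor C with progress-or-stuck (λ t → S? t ⊎-dec IsIdle? t) C
  ... | inj₁ (D , st , D≉C) = D , st , ⊥-elim ∘ D≉C
  ... | inj₂ stuck = C , idle-step C , λ _ → stuck

  run : Config n → ℕ → Config n
  run C zero = C
  run C (suc i) = proj₁ (successor (run C i))

  run-step : ∀ C i → Step (Restrict S) (run C i) (run C (suc i))
  run-step C i = proj₁ (proj₂ (successor (run C i)))

  run-reach : ∀ C i → Reach (Restrict S) C (run C i)
  run-reach C zero = ε
  run-reach C (suc i) = run-reach C i ◅◅ (run-step C i ◅ ε)

  terminal-reachable : (∀ C e → IsExecution (Restrict S) C e → Silent e) →
                       ∀ C → ∃[ C′ ] (Reach (Restrict S) C C′ × Terminal (Restrict S) C′)
  terminal-reachable silent C with silent C (run C) ((λ s → refl) , run-step C)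
  ... | N , settled = run C N , run-reach C N ,
    Stuck⇒Terminal (proj₂ (proj₂ (successor (run C N))) (settled (suc N) (n≤1+n N)))

module Layered (P : Protocol) (layered : LayeredTermination P) where
  open Protocol P
  open OrderedPartition (proj₁ layered)

  InT : Trans (suc k) → Set
  InT t = T t ≡ true

  -- Prefix j is T_1 ∪ … ∪ T_j, and Below i unfolds to Prefix (toℕ i).
  Prefix : ℕ → Trans (suc k) → Set
  Prefix j t = ∃[ i ] (toℕ i Nat.< j × Layer i t)

  ReachesTerminal : ℕ → Config (suc k) → Set
  ReachesTerminal j C = ∃[ C′ ] (Reach (Restrict InT) C C′ × Terminal (Restrict (Prefix j)) C′)

  Prefix-zero : Restrict (Prefix 0) ⊆ IsIdle
  Prefix-zero (inj₂ idle) = idle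

  Prefix-suc : ∀ i → Restrict (Prefix (suc (toℕ i))) ⊆ Restrict (Below i) ∪ Restrict (Layer i)
  Prefix-suc i (inj₂ idle) = inj₁ (inj₂ idle)
  Prefix-suc i (inj₁ (j , j<1+i , tʲ)) with m<1+n⇒m<n∨m≡n j<1+i
  ... | inj₁ j<i = inj₁ (inj₁ (j , j<i , tʲ))
  ... | inj₂ j≡i = inj₂ (inj₁ (subst (λ j → Layer j _) (toℕ-injective j≡i) tʲ))

  Restrict-Layer⊆Restrict-InT : ∀ i → Restrict (Layer i) ⊆ Restrict InT
  Restrict-Layer⊆Restrict-InT i {t} = map₁ (cover₂ t i)

  layer-terminal-reachable : ∀ i C →
    ∃[ C′ ] (Reach (Restrict (Layer i)) C C′ × Terminal (Restrict (Layer i)) C′)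
  layer-terminal-reachable i =
    Greedy.terminal-reachable (λ t → layer i t Bool.≟ true) (proj₁ (proj₂ layered i))

  ReachesTerminal-suc : ∀ {j C} (i : Fin l) → toℕ i ≡ j →
                        ReachesTerminal j C → ReachesTerminal (suc j) C
  ReachesTerminal-suc i refl (C₁ , C⇝C₁ , terminal₁) =
    let C₂ , C₁⇝C₂ , terminalᵢ = layer-terminal-reachable i C₁
        terminalᴮ = proj₂ (proj₂ layered i) C₁ C₂ C₁⇝C₂ terminal₁
    in C₂ , C⇝C₁ ◅◅ Reach-mono (Restrict-Layer⊆Restrict-InT i) C₁⇝C₂ ,
       Terminal-∪ (Prefix-suc i) terminalᴮ terminalᵢ

  reachesTerminal : ∀ j → j ≤ l → ∀ C → ReachesTerminal j C
  reachesTerminal zero _ C = C , ε , Stuck⇒Terminal (Stuck-idle Prefix-zero)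
  reachesTerminal (suc j) j<l C =
    ReachesTerminal-suc (fromℕ< j<l) (toℕ-fromℕ< j<l) (reachesTerminal j (<⇒≤ j<l) C)

  InT⊆Prefix : InT ⊆ Restrict (Prefix l)
  InT⊆Prefix {t} tᵀ with cover₁ t tᵀ
  ... | i , tⁱ = inj₁ (i , toℕ<n i , tⁱ)

  termination : Termination P
  termination C with reachesTerminal l ≤-refl C
  ... | C′ , C⇝C′ , terminal with Reach-dropIdle (λ s → refl) C⇝C′
  ... | C″ , C⇝C″ , C″≈C′ = C″ , C⇝C″ , Terminal-respˡ C″≈C′ (Terminal-anti InT⊆Prefix terminal)

proposition8 : (P : Protocol) → LayeredTermination P → Termination P
proposition8 = Layered.termination
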